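{- Consider any exact dynamic predecessor or rank structure obtained by a $\beta$-ary levelled decomposition with $h+1$ active levels. There exists a set of live keys and a query $q$ for which the structure must inspect all $h+1$ active levels. Consequently, the additive query overhead in this family is $\Omega(h)=\Omega(\log_\beta n)$.
   Context: A $\beta$-ary levelled decomposition of a dynamic ordered set of $n$ live keys distributes the live keys among levels $L_0,\dots,L_h$ ($h=\Theta(\log_\beta n)$ in the worst case), each active level storing its keys in a separate structure; a query's execution depends only on the contents of the levels it inspects. An exact structure always returns the correct predecessor $\max\{x\text{ live}:x\le q\}$ (resp. rank). -}

module Defs where

open import Data.Nat using (ℕ; suc; _≤_; _^_; _≤?_; _⊔_)
open import Data.Fin using (Fin; toℕ)
open import Data.List using (List; []; _∷_; length; concatMap; filter; allFin)
open import Data.List.Relation.Unary.Unique.Propositional using (Unique)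
open import Data.Maybe using (Maybe; just; nothing)
open import Data.Bool using (Bool; true; T; if_then_else_)
open import Data.Product using (_×_; proj₁; proj₂)
open import Relation.Nullary.Decidable using (does)
open import Relation.Binary.PropositionalEquality using (_≡_)

Config : ℕ → Set
Config h = Fin (suc h) → List ℕ

live : ∀ {h} → Config h → List ℕ
live {h} C = concatMap C (allFin (suc h))

Valid : (β h : ℕ) → Config h → Set
Valid β h C =
  (∀ (i : Fin (suc h)) → 1 ≤ length (C i) × length (C i) ≤ β ^ toℕ i)
  × Unique (live C)

predL : List ℕ → ℕ → Maybe ℕ
predL [] q = nothing
predL (x ∷ xs) q with predL xs q
... | nothing = if does (x ≤? q) then just x else nothing
... | just m  = if does (x ≤? q) then just (x ⊔ m) else just m

rankL : List ℕ → ℕ → ℕ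
rankL xs q = length (filter (_≤? q) xs)

predSpec : ∀ {h} → Config h → ℕ → Maybe ℕ
predSpec C q = predL (live C) q

rankSpec : ∀ {h} → Config h → ℕ → ℕ
rankSpec C q = rankL (live C) q

-- A query procedure over the decomposition (with answers of type A).
-- run q C = (set of inspected levels, answer).
record ExactQuery (β h : ℕ) (A : Set) (spec : Config h → ℕ → A) : Set where
  field
    run   : ℕ → Config h → (Fin (suc h) → Bool) × A
    local : ∀ q (C C′ : Config h) → Valid β h C → Valid β h C′ →
            (∀ i → T (proj₁ (run q C) i) → C′ i ≡ C i) →
            run q C′ ≡ run q C
    exact : ∀ q (C : Config h) → Valid β h C → proj₂ (run q C) ≡ spec C q

  inspected : ℕ → Config h → Fin (suc h) → Bool
  inspected q C = proj₁ (run q C)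

ForcesAllLevels : ∀ {β h A spec} → ExactQuery β h A spec → Set
ForcesAllLevels {β} {h} Q =
  Data.Product.Σ (Config h) λ C → Valid β h C Data.Product.×
    Data.Product.Σ ℕ λ q → ∀ (i : Fin (suc h)) → ExactQuery.inspected Q q C i ≡ true

module Submission where

open import Defs
open import Data.Nat using (ℕ; _≤_)
open import Data.Maybe using (Maybe)
open import Data.Product using (_×_)

open import Data.Nat using (suc; _<_; _≤?_; z<s; NonZero; >-nonZero)
open import Data.Nat.Properties using (≤-refl; ≤-reflexive; <⇒≤; <⇒≱; n>0⇒n≢0; suc-injective; m^n>0)
open import Data.Fin using (Fin; toℕ; _≟_)
open import Data.Fin.Properties using (toℕ-injective)
open import Data.List using (_∷_; [_]; map; length; concatMap; allFin)
open import Data.List.Properties using (concatMap-map; concatMap-pure; filter-none; filter-some)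
open import Data.List.Membership.Propositional using (_∈_)
open import Data.List.Membership.Propositional.Properties using (∈-allFin; ∈-map⁺)
open import Data.List.Relation.Unary.All as All using (All; []; _∷_)
open import Data.List.Relation.Unary.All.Properties as All using ()
open import Data.List.Relation.Unary.Any as Any using (Any; here; there)
open import Data.List.Relation.Unary.Unique.Propositional using (Unique)
open import Data.List.Relation.Unary.Unique.Propositional.Properties as Unique using (allFin⁺)
open import Data.Maybe using (just; nothing)
open import Data.Bool using (true; false; T)
open import Data.Product using (_,_; proj₂)
open import Data.Vec.Functional using (updateAt)
open import Data.Vec.Functional.Properties using (updateAt-updates; updateAt-minimal)
open import Data.Empty using (⊥-elim)
open import Function using (_∘_; const)
open import Function.Definitions using (Injective)
open import Relation.Nullary using (yes; no; does)
open import Relation.Nullary.Decidable using (dec-true; dec-false)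
open import Relation.Binary.PropositionalEquality using (_≡_; _≢_; refl; sym; trans; cong; subst; module ≡-Reasoning)
open ≡-Reasoning

module _ {β h A spec} (Q : ExactQuery β h A spec) where
  open ExactQuery Q

  inspected-if-answer-depends-on : ∀ {q C C′} (i : Fin (suc h)) →
    Valid β h C → Valid β h C′ → (∀ j → j ≢ i → C′ j ≡ C j) →
    spec C′ q ≢ spec C q → inspected q C i ≡ true
  inspected-if-answer-depends-on {q} {C} {C′} i valid valid′ outside-i answers-differ
    with inspected q C i in skipped
  ... | true = refl
  ... | false = ⊥-elim (answers-differ (begin
    spec C′ q            ≡⟨ sym (exact q C′ valid′) ⟩
    proj₂ (run q C′)     ≡⟨ cong proj₂ (local q C C′ valid valid′ agree) ⟩
    proj₂ (run q C)      ≡⟨ exact q C valid ⟩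
    spec C q             ∎))
    where
    agree : ∀ j → T (inspected q C j) → C′ j ≡ C j
    agree j inspected-j with j ≟ i
    ... | yes refl = ⊥-elim (subst T skipped inspected-j)
    ... | no j≢i   = outside-i j j≢i

singletons : ∀ {h} → (Fin (suc h) → ℕ) → Config h
singletons keys i = [ keys i ]

live-singletons : ∀ {h} (keys : Fin (suc h) → ℕ) → live (singletons keys) ≡ map keys (allFin (suc h))
live-singletons {h} keys = begin
  live (singletons keys)                        ≡⟨ concatMap-map [_] keys (allFin (suc h)) ⟨
  concatMap [_] (map keys (allFin (suc h)))    ≡⟨ concatMap-pure (map keys (allFin (suc h))) ⟩
  map keys (allFin (suc h))                     ∎

∈-live-singletons : ∀ {h} (keys : Fin (suc h) → ℕ) i → keys i ∈ live (singletons keys)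
∈-live-singletons keys i = subst (keys i ∈_) (sym (live-singletons keys)) (∈-map⁺ keys (∈-allFin i))

singletons-valid : ∀ {β h} .{{_ : NonZero β}} {keys : Fin (suc h) → ℕ} →
  Injective _≡_ _≡_ keys → Valid β h (singletons keys)
singletons-valid {β} {h} {keys} keys-injective =
  (λ i → ≤-refl , m^n>0 β (toℕ i)) ,
  subst Unique (sym (live-singletons keys)) (Unique.map⁺ keys-injective (allFin⁺ (suc h)))

module _ {n} {A : Set} (v : Fin n → A) (i : Fin n) (a : A) where

  updateAt-const-injective : Injective _≡_ _≡_ v → (∀ j → v j ≢ a) →
    Injective _≡_ _≡_ (updateAt v i (const a))
  updateAt-const-injective v-injective a∉v {x} {y} e with x ≟ i | y ≟ i
  ... | yes refl | yes refl = refl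
  ... | yes refl | no y≢i   = ⊥-elim (a∉v y (begin
    v y                        ≡⟨ updateAt-minimal y i v y≢i ⟨
    updateAt v i (const a) y   ≡⟨ e ⟨
    updateAt v i (const a) i   ≡⟨ updateAt-updates i v ⟩
    a                          ∎))
  ... | no x≢i   | yes refl = ⊥-elim (a∉v x (begin
    v x                        ≡⟨ updateAt-minimal x i v x≢i ⟨
    updateAt v i (const a) x   ≡⟨ e ⟩
    updateAt v i (const a) i   ≡⟨ updateAt-updates i v ⟩
    a                          ∎))
  ... | no x≢i   | no y≢i   = v-injective (begin
    v x                        ≡⟨ updateAt-minimal x i v x≢i ⟨
    updateAt v i (const a) x   ≡⟨ e ⟩
    updateAt v i (const a) y   ≡⟨ updateAt-minimal y i v y≢i ⟩
    v y                        ∎)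

predL-none : ∀ {q xs} → All (q <_) xs → predL xs q ≡ nothing
predL-none [] = refl
predL-none {q} {x ∷ xs} (q<x ∷ q<xs) with predL xs q | predL-none q<xs
... | nothing | _ rewrite dec-false (x ≤? q) (<⇒≱ q<x) = refl

predL-some : ∀ {q xs} → Any (_≤ q) xs → predL xs q ≢ nothing
predL-some {q} {x ∷ xs} (here x≤q) with predL xs q
... | nothing rewrite dec-true (x ≤? q) x≤q = λ ()
... | just _  rewrite dec-true (x ≤? q) x≤q = λ ()
predL-some {q} {x ∷ xs} (there x≤q∈xs) with predL xs q in pred-xs
... | nothing = λ _ → predL-some x≤q∈xs pred-xs
... | just _ with does (x ≤? q)
...   | true  = λ ()
...   | false = λ ()

rankL-none : ∀ {q xs} → All (q <_) xs → rankL xs q ≡ 0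
rankL-none {q} q<xs = cong length (filter-none (_≤? q) (All.map <⇒≱ q<xs))

rankL-some : ∀ {q xs} → Any (_≤ q) xs → rankL xs q ≢ 0
rankL-some {q} x≤q∈xs = n>0⇒n≢0 (filter-some (_≤? q) x≤q∈xs)

-- Level j holds the single key 1 + j, so nothing is ≤ 0; putting 0 into level i
-- instead is invisible to a query at 0 that skips level i, but changes its answer.
forcesAllLevels-if-answer-detects-keys-below : ∀ {β h A spec} .{{_ : NonZero β}} (none : A) →
  (∀ {C : Config h} {q} → All (q <_) (live C) → spec C q ≡ none) →
  (∀ {C : Config h} {q} → Any (_≤ q) (live C) → spec C q ≢ none) →
  (Q : ExactQuery β h A spec) → ForcesAllLevels Q
forcesAllLevels-if-answer-detects-keys-below {β} {h} {spec = spec} none spec-none spec-some Q =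
  singletons positive , singletons-valid positive-injective , 0 , λ i →
    inspected-if-answer-depends-on Q i
      (singletons-valid positive-injective)
      (singletons-valid (updateAt-const-injective positive i 0 positive-injective (λ _ ())))
      (λ j j≢i → cong [_] (updateAt-minimal j i positive j≢i))
      (answer-changes i)
  where
  positive : Fin (suc h) → ℕ
  positive = suc ∘ toℕ

  positive-injective : Injective _≡_ _≡_ positive
  positive-injective = toℕ-injective ∘ suc-injective

  zero-at : Fin (suc h) → Fin (suc h) → ℕ
  zero-at i = updateAt positive i (const 0)

  positive-keys-above-0 : All (0 <_) (live (singletons positive))
  positive-keys-above-0 = subst (All (0 <_)) (sym (live-singletons positive))
    (All.map⁺ (All.universal (λ _ → z<s) (allFin (suc h))))

  zero-at-has-key-≤0 : ∀ i → Any (_≤ 0) (live (singletons (zero-at i)))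
  zero-at-has-key-≤0 i = Any.map (λ key≡ → ≤-reflexive (trans (sym key≡) (updateAt-updates i positive)))
    (∈-live-singletons (zero-at i) i)

  answer-changes : ∀ i → spec (singletons (zero-at i)) 0 ≢ spec (singletons positive) 0
  answer-changes i same = spec-some (zero-at-has-key-≤0 i) (trans same (spec-none positive-keys-above-0))

theorem4 : (β h : ℕ) → 2 ≤ β →
    ((Q : ExactQuery β h (Maybe ℕ) predSpec) → ForcesAllLevels Q)
    × ((Q : ExactQuery β h ℕ rankSpec) → ForcesAllLevels Q)
theorem4 β h 2≤β =
  forcesAllLevels-if-answer-detects-keys-below nothing predL-none predL-some ,
  forcesAllLevels-if-answer-detects-keys-below 0 rankL-none rankL-some
  where
  instance
    β-nonZero : NonZero β
    β-nonZero = >-nonZero (<⇒≤ 2≤β)
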